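{- Let $n \geq 1$ be an integer. (1) The matrices $D_{n,0}$ and $D_{n,n}$ belong to $\mathcal{M}_{1,0}$. (2) For every integer $k$ such that $n>k>0$, the matrix $D_{n,k}$ belongs to $\mathcal{M}_{n,d-1}$ for $d = \gcd(n,k)$.
   Context: For integers $n \ge k \ge 0$, $D_{n,k}$ denotes the $n\times n$ circulant $0,1$ matrix whose first row consists of $n-k$ ones followed by $k$ zeros, each subsequent row being the cyclic shift of the previous row by one position to the right. For integers $t > r \geq 0$, $\mathcal{M}_{t,r}$ is the collection of all $0,1$ matrices $A$ of dimensions $n \times n$ (for some $n \geq 1$) for which there exist sets $A_1, \ldots, A_t \subseteq [n]$ (of rows) and $B_1, \ldots, B_t \subseteq [n]$ (of columns) such that: (1) the combinatorial rectangles $A_1 \times B_1, \ldots, A_t \times B_t$ form a partition of the ones in $A$ (each rectangle consists only of one-entries, and every one-entry lies in exactly one rectangle); (2) the sets $A_1, \ldots, A_r$ are pairwise disjoint; (3) there exists a set $L \subseteq [t] \setminus [r]$ for which the sets $B_l$ with $l \in L$ form a partition of $[n]$; (4) for every $s \in [r]$, there exists a set $L_s \subseteq [t] \setminus [r]$ for which the sets $B_l$ with $l \in L_s$ form a partition of $[n] \setminus B_s$. -}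

module Defs where

open import Data.Nat using (ℕ; zero; suc; _+_; _∸_; _<_; _≤_; _≤ᵇ_; _<ᵇ_)
open import Data.Fin using (Fin; toℕ)
open import Data.Bool using (Bool; true; false; if_then_else_)
open import Data.Product using (Σ; ∃; ∃-syntax; _×_)
open import Relation.Binary.PropositionalEquality using (_≡_; _≢_)
open import Relation.Nullary using (¬_)

-- An n×n 0,1 matrix: entry true = one, false = zero.
Matrix01 : ℕ → Set
Matrix01 n = Fin n → Fin n → Bool

SubsetOf : ℕ → Set
SubsetOf n = Fin n → Bool

cycOffset : (n i j : ℕ) → ℕ
cycOffset n i j = if i ≤ᵇ j then j ∸ i else (j + n) ∸ i

-- D_{n,k}: first row = (n-k) ones followed by k zeros; row i is the first
-- row cyclically shifted i positions to the right, so entry (i,j) equals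
-- entry (0, (j - i) mod n) of the first row.
D : (n k : ℕ) → Matrix01 n
D n k i j = cycOffset n (toℕ i) (toℕ j) <ᵇ (n ∸ k)

∃!′ : {t : ℕ} → (Fin t → Set) → Set
∃!′ {t} P = ∃[ l ] (P l × (∀ l′ → P l′ → l′ ≡ l))

FormsPartitionOf : {t n : ℕ} → (Fin t → SubsetOf n) → (Fin t → Bool) → SubsetOf n → Set
FormsPartitionOf {t} {n} B L S =
  (∀ (l : Fin t) (j : Fin n) → L l ≡ true → B l j ≡ true → S j ≡ true) ×
  (∀ (j : Fin n) → S j ≡ true → ∃!′ (λ l → (L l ≡ true) × (B l j ≡ true)))

-- L ⊆ [t] ∖ [r]   (indices 0-based: l ∈ [r] iff toℕ l < r)
OutsideFirst : {t : ℕ} → ℕ → (Fin t → Bool) → Set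
OutsideFirst {t} r L = ∀ (l : Fin t) → L l ≡ true → r ≤ toℕ l

full : {n : ℕ} → SubsetOf n
full _ = true

complementOf : {n : ℕ} → SubsetOf n → SubsetOf n
complementOf S j = if S j then false else true

InM : (t r : ℕ) → {n : ℕ} → Matrix01 n → Set
InM t r {n} M =
  Σ (Fin t → SubsetOf n) λ As →
  Σ (Fin t → SubsetOf n) λ Bs →
    ((∀ (l : Fin t) (i j : Fin n) → As l i ≡ true → Bs l j ≡ true → M i j ≡ true) ×
     (∀ (i j : Fin n) → M i j ≡ true →
        ∃!′ (λ l → (As l i ≡ true) × (Bs l j ≡ true))))
  × (∀ (l l′ : Fin t) → toℕ l < r → toℕ l′ < r → l ≢ l′ →
       ∀ (i : Fin n) → ¬ ((As l i ≡ true) × (As l′ i ≡ true)))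
  × (∃[ L ] (OutsideFirst r L × FormsPartitionOf Bs L full))
  × (∀ (s : Fin t) → toℕ s < r →
       ∃[ Ls ] (OutsideFirst r Ls × FormsPartitionOf Bs Ls (complementOf (Bs s))))

{-# OPTIONS --safe #-}
module Submission where

-- Index the rectangles by their first column b. Rectangle b consists of the window of the d
-- consecutive columns b, b + 1, …, b + d − 1 (mod n), times the rows i whose cyclic distance to b is
-- a multiple of d leaving room for a whole window inside the n − k ones of row i. Because d divides
-- n and n − k, a one-entry at cyclic distance o = q d + r (r < d) lies exactly in the rectangle
-- starting at column i + q d. Row sets of rectangles with first columns in different residue
-- classes mod d are disjoint, which handles the first d − 1 rectangles, and the windows starting in
-- one residue class tile ℤ/n, which gives the required column partitions.

open import Defs
open import Data.Nat using (ℕ; _≤_; _<_; _∸_)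
open import Data.Nat.GCD using (gcd)
open import Data.Product using (_×_)

open import Data.Bool using (Bool; true; false; if_then_else_)
open import Data.Empty using (⊥-elim)
open import Data.Fin using (Fin; toℕ; fromℕ<; zero; _≟_)
open import Data.Fin.Properties using (toℕ<n; toℕ-injective; toℕ-fromℕ<)
open import Data.Nat
  using (zero; _+_; _*_; _%_; _≤ᵇ_; NonZero; z≤n; z<s; ≢-nonZero; ≢-nonZero⁻¹; >-nonZero)
  renaming (_≟_ to _≟ℕ_)
open import Data.Nat.Properties hiding (_≟_)
open import Data.Nat.DivMod
open import Data.Nat.Divisibility
open import Data.Nat.GCD using (gcd[m,n]∣m; gcd[m,n]∣n; gcd[m,n]≢0)
open import Data.Product using (∃; _,_; proj₁; proj₂)
open import Data.Sum using (inj₁; inj₂)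
open import Relation.Binary.PropositionalEquality
open import Relation.Nullary using (Dec; yes; no; does; ¬_)
open import Relation.Nullary.Decidable using (dec-true; dec-false; _×-dec_; ¬?)

does⇒ : ∀ {A : Set} (a? : Dec A) → does a? ≡ true → A
does⇒ (yes a) _ = a
does⇒ (no _) ()

complement-does⇒¬ : ∀ {A : Set} (a? : Dec A) → (if does a? then false else true) ≡ true → ¬ A
complement-does⇒¬ (yes _) ()
complement-does⇒¬ (no ¬a) _ = ¬a

¬⇒complement-does : ∀ {A : Set} (a? : Dec A) → ¬ A → (if does a? then false else true) ≡ true
¬⇒complement-does a? ¬a rewrite dec-false a? ¬a = refl

∃!′-map : ∀ {t} {P Q : Fin t → Set} →
          (∀ l → P l → Q l) → (∀ l → Q l → P l) → ∃!′ P → ∃!′ Q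
∃!′-map P⇒Q Q⇒P (l , Pl , unique) = l , P⇒Q l Pl , λ l′ Ql′ → unique l′ (Q⇒P l′ Ql′)

∣m∣n⇒∣m∸n : ∀ {d m n} → n ≤ m → d ∣ m → d ∣ n → d ∣ m ∸ n
∣m∣n⇒∣m∸n n≤m d∣m d∣n = ∣m+n∣m⇒∣n (subst (_ ∣_) (sym (m+[n∸m]≡n n≤m)) d∣m) d∣n

∣m∣n⇒m<n⇒m+d≤n : ∀ {d m n} → d ∣ m → d ∣ n → m < n → m + d ≤ n
∣m∣n⇒m<n⇒m+d≤n {d} (divides-refl p) (divides-refl q) pd<qd =
  subst (_≤ q * d) (+-comm d (p * d)) (*-monoˡ-≤ d (*-cancelʳ-< d p q pd<qd))

infix 4 _≡_[mod_]
_≡_[mod_] : ℕ → ℕ → (N : ℕ) → .{{NonZero N}} → Set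
x ≡ y [mod N ] = x % N ≡ y % N

module _ {N : ℕ} .{{_ : NonZero N}} where
  open ≡-Reasoning

  0%≡0 : 0 % N ≡ 0
  0%≡0 = m<n⇒m%n≡m (n≢0⇒n>0 (≢-nonZero⁻¹ N))

  +-congˡ-mod : ∀ z {x y} → x ≡ y [mod N ] → z + x ≡ z + y [mod N ]
  +-congˡ-mod z {x} {y} x≡y = begin
    (z + x) % N             ≡⟨ %-distribˡ-+ z x N ⟩
    (z % N + x % N) % N     ≡⟨ cong (λ u → (z % N + u) % N) x≡y ⟩
    (z % N + y % N) % N     ≡⟨ %-distribˡ-+ z y N ⟨
    (z + y) % N             ∎

  +-congʳ-mod : ∀ z {x y} → x ≡ y [mod N ] → x + z ≡ y + z [mod N ]
  +-congʳ-mod z {x} {y} x≡y = begin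
    (x + z) % N   ≡⟨ cong (_% N) (+-comm x z) ⟩
    (z + x) % N   ≡⟨ +-congˡ-mod z x≡y ⟩
    (z + y) % N   ≡⟨ cong (_% N) (+-comm z y) ⟩
    (y + z) % N   ∎

  +-cancelˡ-mod : ∀ z {x y} → z + x ≡ z + y [mod N ] → x ≡ y [mod N ]
  +-cancelˡ-mod z {x} {y} z+x≡z+y = begin
    x % N               ≡⟨ +-congʳ-mod x w+z≡0 ⟨
    (w + z + x) % N     ≡⟨ cong (_% N) (+-assoc w z x) ⟩
    (w + (z + x)) % N   ≡⟨ +-congˡ-mod w z+x≡z+y ⟩
    (w + (z + y)) % N   ≡⟨ cong (_% N) (+-assoc w z y) ⟨
    (w + z + y) % N     ≡⟨ +-congʳ-mod y w+z≡0 ⟩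
    y % N               ∎
    where
    w = N ∸ z % N
    w+z≡0 : w + z ≡ 0 [mod N ]
    w+z≡0 = begin
      (w + z) % N       ≡⟨ +-congˡ-mod w (sym (m%n%n≡m%n z N)) ⟩
      (w + z % N) % N   ≡⟨ cong (_% N) (m∸n+n≡m (m%n≤n z N)) ⟩
      N % N             ≡⟨ n%n≡0 N ⟩
      0                 ≡⟨ 0%≡0 ⟨
      0 % N             ∎

  +-cancelʳ-mod : ∀ z {x y} → x + z ≡ y + z [mod N ] → x ≡ y [mod N ]
  +-cancelʳ-mod z {x} {y} x+z≡y+z =
    +-cancelˡ-mod z (trans (cong (_% N) (+-comm z x)) (trans x+z≡y+z (cong (_% N) (+-comm y z))))

  ≡-mod⇒≡ : ∀ {x y} → x < N → y < N → x ≡ y [mod N ] → x ≡ y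
  ≡-mod⇒≡ x<N y<N x≡y = trans (sym (m<n⇒m%n≡m x<N)) (trans x≡y (m<n⇒m%n≡m y<N))

  ≡-mod-∣ : ∀ {d x y} .{{_ : NonZero d}} → d ∣ N → x ≡ y [mod N ] → x ≡ y [mod d ]
  ≡-mod-∣ {d} {x} {y} d∣N x≡y =
    trans (sym (m∣n⇒o%n%m≡o%m d N x d∣N)) (trans (cong (_% d) x≡y) (m∣n⇒o%n%m≡o%m d N y d∣N))

cycOffset-≤ : ∀ {n i j} → i ≤ j → cycOffset n i j ≡ j ∸ i
cycOffset-≤ {n} {i} {j} i≤j with i ≤ᵇ j | ≤⇒≤ᵇ i≤j
... | true | _ = refl

cycOffset-> : ∀ {n i j} → j < i → cycOffset n i j ≡ (j + n) ∸ i
cycOffset-> {n} {i} {j} j<i with i ≤ᵇ j | ≤ᵇ⇒≤ i j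
... | false | _ = refl
... | true | i≤j = ⊥-elim (<⇒≱ j<i (i≤j _))

module CyclicOffset (n : ℕ) .{{_ : NonZero n}} where
  open ≡-Reasoning

  offset : Fin n → Fin n → ℕ
  offset i j = cycOffset n (toℕ i) (toℕ j)

  offset-< : ∀ i j → offset i j < n
  offset-< i j with ≤-<-connex (toℕ i) (toℕ j)
  ... | inj₁ i≤j rewrite cycOffset-≤ {n} i≤j = ≤-<-trans (m∸n≤m (toℕ j) (toℕ i)) (toℕ<n j)
  ... | inj₂ j<i rewrite cycOffset-> {n} j<i = m<n+o⇒m∸n<o (toℕ j + n) (toℕ i) (+-monoˡ-< n j<i)

  offset-spec : ∀ i j → toℕ i + offset i j ≡ toℕ j [mod n ]
  offset-spec i j with ≤-<-connex (toℕ i) (toℕ j)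
  ... | inj₁ i≤j rewrite cycOffset-≤ {n} i≤j = cong (_% n) (m+[n∸m]≡n i≤j)
  ... | inj₂ j<i rewrite cycOffset-> {n} j<i =
    trans (cong (_% n) (m+[n∸m]≡n (≤-trans (<⇒≤ (toℕ<n i)) (m≤n+m n (toℕ j))))) ([m+n]%n≡m%n (toℕ j) n)

  offset-unique : ∀ i j {o} → o < n → toℕ i + o ≡ toℕ j [mod n ] → offset i j ≡ o
  offset-unique i j o<n i+o≡j =
    ≡-mod⇒≡ (offset-< i j) o<n (+-cancelˡ-mod (toℕ i) (trans (offset-spec i j) (sym i+o≡j)))

  offset-+ : ∀ i b j → offset i b + offset b j < n → offset i j ≡ offset i b + offset b j
  offset-+ i b j sum<n = offset-unique i j sum<n (begin
    (toℕ i + (offset i b + offset b j)) % n   ≡⟨ cong (_% n) (+-assoc (toℕ i) _ _) ⟨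
    (toℕ i + offset i b + offset b j) % n     ≡⟨ +-congʳ-mod (offset b j) (offset-spec i b) ⟩
    (toℕ b + offset b j) % n                  ≡⟨ offset-spec b j ⟩
    toℕ j % n                                 ∎)

  offset-∸ : ∀ i b j → offset b j ≤ offset i j → offset i b ≡ offset i j ∸ offset b j
  offset-∸ i b j bj≤ij = offset-unique i b (≤-<-trans (m∸n≤m (offset i j) (offset b j)) (offset-< i j))
    (+-cancelʳ-mod (offset b j) (begin
      (toℕ i + (offset i j ∸ offset b j) + offset b j) % n   ≡⟨ cong (_% n) (+-assoc (toℕ i) _ _) ⟩
      (toℕ i + (offset i j ∸ offset b j + offset b j)) % n   ≡⟨ cong (λ u → (toℕ i + u) % n) (m∸n+n≡m bj≤ij) ⟩
      (toℕ i + offset i j) % n                               ≡⟨ offset-spec i j ⟩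
      toℕ j % n                                              ≡⟨ offset-spec b j ⟨
      (toℕ b + offset b j) % n                               ∎))

  offset-reach : ∀ j {ρ} → ρ < n → ∃ λ b → offset b j ≡ ρ
  offset-reach j {ρ} ρ<n = b , offset-unique b j ρ<n (begin
    (toℕ b + ρ) % n                     ≡⟨ cong (λ u → (u + ρ) % n) (toℕ-fromℕ< _) ⟩
    ((toℕ j + (n ∸ ρ)) % n + ρ) % n     ≡⟨ +-congʳ-mod ρ (m%n%n≡m%n _ n) ⟩
    (toℕ j + (n ∸ ρ) + ρ) % n           ≡⟨ cong (_% n) (+-assoc (toℕ j) _ ρ) ⟩
    (toℕ j + (n ∸ ρ + ρ)) % n           ≡⟨ cong (λ u → (toℕ j + u) % n) (m∸n+n≡m (<⇒≤ ρ<n)) ⟩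
    (toℕ j + n) % n                     ≡⟨ [m+n]%n≡m%n (toℕ j) n ⟩
    toℕ j % n                           ∎)
    where b = fromℕ< (m%n<n (toℕ j + (n ∸ ρ)) n)

module Windows (n d : ℕ) .{{_ : NonZero n}} .{{_ : NonZero d}} (d∣n : d ∣ n) where
  open CyclicOffset n public
  open ≡-Reasoning

  offset-spec-mod-d : ∀ i j → toℕ i + offset i j ≡ toℕ j [mod d ]
  offset-spec-mod-d i j = ≡-mod-∣ d∣n (offset-spec i j)

  ∣offset⇒≡mod : ∀ i b → d ∣ offset i b → toℕ i ≡ toℕ b [mod d ]
  ∣offset⇒≡mod i b d∣o = begin
    toℕ i % d                    ≡⟨ cong (_% d) (+-identityʳ (toℕ i)) ⟨
    (toℕ i + 0) % d              ≡⟨ +-congˡ-mod (toℕ i) (trans (n∣m⇒m%n≡0 _ d d∣o) (sym 0%≡0)) ⟨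
    (toℕ i + offset i b) % d     ≡⟨ offset-spec-mod-d i b ⟩
    toℕ b % d                    ∎

  ≡mod⇒∣offset : ∀ i b → toℕ i ≡ toℕ b [mod d ] → d ∣ offset i b
  ≡mod⇒∣offset i b i≡b = m%n≡0⇒n∣m _ d (trans o≡0 0%≡0)
    where
    o≡0 : offset i b ≡ 0 [mod d ]
    o≡0 = +-cancelˡ-mod (toℕ i) (begin
      (toℕ i + offset i b) % d   ≡⟨ offset-spec-mod-d i b ⟩
      toℕ b % d                  ≡⟨ i≡b ⟨
      toℕ i % d                  ≡⟨ cong (_% d) (+-identityʳ (toℕ i)) ⟨
      (toℕ i + 0) % d            ∎)

  window-unique : ∀ {b b′ j} → toℕ b ≡ toℕ b′ [mod d ] → offset b j < d → offset b′ j < d → b ≡ b′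
  window-unique {b} {b′} {j} b≡b′ bj<d b′j<d =
    toℕ-injective (≡-mod⇒≡ (toℕ<n b) (toℕ<n b′) (+-cancelʳ-mod (offset b j) (begin
      (toℕ b + offset b j) % n    ≡⟨ offset-spec b j ⟩
      toℕ j % n                   ≡⟨ offset-spec b′ j ⟨
      (toℕ b′ + offset b′ j) % n  ≡⟨ cong (λ o → (toℕ b′ + o) % n) same-offset ⟨
      (toℕ b′ + offset b j) % n   ∎)))
    where
    same-offset : offset b j ≡ offset b′ j
    same-offset = ≡-mod⇒≡ bj<d b′j<d (+-cancelˡ-mod (toℕ b) (begin
      (toℕ b + offset b j) % d     ≡⟨ offset-spec-mod-d b j ⟩
      toℕ j % d                    ≡⟨ offset-spec-mod-d b′ j ⟨
      (toℕ b′ + offset b′ j) % d   ≡⟨ +-congʳ-mod (offset b′ j) b≡b′ ⟨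
      (toℕ b + offset b′ j) % d    ∎))

  window-exists : ∀ c j → ∃ λ b → toℕ b ≡ toℕ c [mod d ] × offset b j ≡ offset c j % d
  window-exists c j = b , b≡c , bj≡ρ
    where
    ρ = offset c j % d
    reach = offset-reach j (<-≤-trans (m%n<n (offset c j) d) (∣⇒≤ d∣n))
    b = proj₁ reach
    bj≡ρ = proj₂ reach
    b≡c : toℕ b ≡ toℕ c [mod d ]
    b≡c = +-cancelʳ-mod ρ (begin
      (toℕ b + ρ) % d              ≡⟨ cong (λ o → (toℕ b + o) % d) bj≡ρ ⟨
      (toℕ b + offset b j) % d     ≡⟨ offset-spec-mod-d b j ⟩
      toℕ j % d                    ≡⟨ offset-spec-mod-d c j ⟨
      (toℕ c + offset c j) % d     ≡⟨ +-congˡ-mod (toℕ c) (m%n%n≡m%n (offset c j) d) ⟨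
      (toℕ c + ρ) % d              ∎)

  window-∃! : ∀ c j → ∃!′ λ b → toℕ b ≡ toℕ c [mod d ] × offset b j < d
  window-∃! c j with window-exists c j
  ... | b , b≡c , bj≡ρ = b , (b≡c , bj<d) , λ b′ (b′≡c , b′j<d) →
    window-unique (trans b′≡c (sym b≡c)) b′j<d bj<d
    where bj<d = subst (_< d) (sym bj≡ρ) (m%n<n (offset c j) d)

module _ (n : ℕ) .{{_ : NonZero n}} where
  open CyclicOffset n

  -- D n k i j reduces to does (offset i j <? n ∸ k), so dec-true, dec-false and does⇒ apply to it directly.
  D-n-0-ones : ∀ i j → D n 0 i j ≡ true
  D-n-0-ones i j = dec-true (offset i j <? n) (offset-< i j)

  D-n-n-zeros : ∀ i j → D n n i j ≡ false
  D-n-n-zeros i j = dec-false (offset i j <? n ∸ n) λ o<0 → n≮0 (subst (offset i j <_) (n∸n≡0 n) o<0)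

module CirculantRectangles (n k d : ℕ) .{{_ : NonZero n}} .{{_ : NonZero d}}
                           (d∣n : d ∣ n) (d∣n∸k : d ∣ n ∸ k) where
  open Windows n d d∣n

  m : ℕ
  m = n ∸ k

  row? : (b i : Fin n) → Dec (d ∣ offset i b × offset i b + d ≤ m)
  row? b i = (d ∣? offset i b) ×-dec (offset i b + d ≤? m)

  col? : (b j : Fin n) → Dec (offset b j < d)
  col? b j = offset b j <? d

  rows cols : Fin n → SubsetOf n
  rows b i = does (row? b i)
  cols b j = does (col? b j)

  rectangle⊆ones : ∀ b i j → rows b i ≡ true → cols b j ≡ true → D n k i j ≡ true
  rectangle⊆ones b i j ib bj = dec-true (offset i j <? m)
    (subst (_< m) (sym (offset-+ i b j (<-≤-trans sum<m (m∸n≤m n k)))) sum<m)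
    where
    sum<m : offset i b + offset b j < m
    sum<m = <-≤-trans (+-monoʳ-< (offset i b) (does⇒ (col? b j) bj)) (proj₂ (does⇒ (row? b i) ib))

  ones⊆rectangle : ∀ i j → D n k i j ≡ true → ∃!′ λ b → rows b i ≡ true × cols b j ≡ true
  ones⊆rectangle i j ij with window-exists i j
  ... | b , b≡i , bj≡o%d = b , (dec-true (row? b i) (d∣ib , ib+d≤m) , dec-true (col? b j) bj<d) , unique
    where
    o = offset i j
    bj<d = subst (_< d) (sym bj≡o%d) (m%n<n o d)
    ib≤o : offset i b ≤ o
    ib≤o = subst (_≤ o) (sym (offset-∸ i b j (subst (_≤ o) (sym bj≡o%d) (m%n≤m o d)))) (m∸n≤m o (offset b j))
    d∣ib = ≡mod⇒∣offset i b (sym b≡i)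
    ib+d≤m = ∣m∣n⇒m<n⇒m+d≤n d∣ib d∣n∸k (≤-<-trans ib≤o (does⇒ (o <? m) ij))
    unique : ∀ b′ → rows b′ i ≡ true × cols b′ j ≡ true → b′ ≡ b
    unique b′ (ib′ , b′j) = window-unique (trans (sym i≡b′) (sym b≡i)) (does⇒ (col? b′ j) b′j) bj<d
      where i≡b′ = ∣offset⇒≡mod i b′ (proj₁ (does⇒ (row? b′ i) ib′))

  d∸1<d : d ∸ 1 < d
  d∸1<d = ∸-monoʳ-< z<s (n≢0⇒n>0 (≢-nonZero⁻¹ d))

  ≡mod-below⇒≡ : ∀ {b b′ : Fin n} → toℕ b < d ∸ 1 → toℕ b′ < d → toℕ b ≡ toℕ b′ [mod d ] → b ≡ b′
  ≡mod-below⇒≡ b<d∸1 b′<d b≡b′ = toℕ-injective (≡-mod⇒≡ (<-trans b<d∸1 d∸1<d) b′<d b≡b′)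

  rows-disjoint : ∀ b b′ → toℕ b < d ∸ 1 → toℕ b′ < d ∸ 1 → b ≢ b′ →
                  ∀ i → ¬ (rows b i ≡ true × rows b′ i ≡ true)
  rows-disjoint b b′ b<d∸1 b′<d∸1 b≢b′ i (ib , ib′) =
    b≢b′ (≡mod-below⇒≡ b<d∸1 (<-trans b′<d∸1 d∸1<d) (trans (sym i≡b) i≡b′))
    where
    i≡b = ∣offset⇒≡mod i b (proj₁ (does⇒ (row? b i) ib))
    i≡b′ = ∣offset⇒≡mod i b′ (proj₁ (does⇒ (row? b′ i) ib′))

  -- The column tiling uses the residue class of d − 1: no index 0, …, d − 2 of a disjoint row set lies in it.
  top : Fin n
  top = fromℕ< (<-≤-trans d∸1<d (∣⇒≤ d∣n))

  same-class? : (b c : Fin n) → Dec (toℕ b ≡ toℕ c [mod d ])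
  same-class? b c = toℕ b % d ≟ℕ toℕ c % d

  tiling : Fin n → Bool
  tiling b = does (same-class? b top)

  tiling-outside : OutsideFirst (d ∸ 1) tiling
  tiling-outside b tb = ≮⇒≥ λ b<d∸1 → <⇒≢ b<d∸1 (trans (cong toℕ (b≡top b<d∸1)) (toℕ-fromℕ< _))
    where
    top<d = subst (_< d) (sym (toℕ-fromℕ< _)) d∸1<d
    b≡top = λ b<d∸1 → ≡mod-below⇒≡ b<d∸1 top<d (does⇒ (same-class? b top) tb)

  tiling-partition : FormsPartitionOf cols tiling full
  tiling-partition = (λ _ _ _ _ → refl) , λ j _ → ∃!′-map
    (λ b (b≡top , bj<d) → dec-true (same-class? b top) b≡top , dec-true (col? b j) bj<d)
    (λ b (tb , bj) → does⇒ (same-class? b top) tb , does⇒ (col? b j) bj)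
    (window-∃! top j)

  complement-tiling? : (s b : Fin n) → Dec (toℕ b ≡ toℕ s [mod d ] × b ≢ s)
  complement-tiling? s b = same-class? b s ×-dec ¬? (b ≟ s)

  complement-tiling : Fin n → Fin n → Bool
  complement-tiling s b = does (complement-tiling? s b)

  complement-tiling-outside : ∀ s → toℕ s < d ∸ 1 → OutsideFirst (d ∸ 1) (complement-tiling s)
  complement-tiling-outside s s<d∸1 b cb with does⇒ (complement-tiling? s b) cb
  ... | b≡s , b≢s = ≮⇒≥ λ b<d∸1 → b≢s (≡mod-below⇒≡ b<d∸1 (<-trans s<d∸1 d∸1<d) b≡s)

  complement-tiling-partition : ∀ s → FormsPartitionOf cols (complement-tiling s) (complementOf (cols s))
  complement-tiling-partition s = inside , covered
    where
    inside : ∀ b j → complement-tiling s b ≡ true → cols b j ≡ true → complementOf (cols s) j ≡ true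
    inside b j cb bj with does⇒ (complement-tiling? s b) cb
    ... | b≡s , b≢s = ¬⇒complement-does (col? s j) λ sj<d → b≢s (window-unique b≡s (does⇒ (col? b j) bj) sj<d)

    covered : ∀ j → complementOf (cols s) j ≡ true → ∃!′ λ b → complement-tiling s b ≡ true × cols b j ≡ true
    covered j j∉s = ∃!′-map
      (λ b (b≡s , bj<d) → dec-true (complement-tiling? s b) (b≡s , λ { refl → s∌j bj<d }) , dec-true (col? b j) bj<d)
      (λ b (cb , bj) → proj₁ (does⇒ (complement-tiling? s b) cb) , does⇒ (col? b j) bj)
      (window-∃! s j)
      where s∌j = complement-does⇒¬ (col? s j) j∉s

  D∈M : InM n (d ∸ 1) (D n k)
  D∈M = rows , cols , (rectangle⊆ones , ones⊆rectangle) , rows-disjoint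
      , (tiling , tiling-outside , tiling-partition)
      , λ s s<d∸1 → complement-tiling s , complement-tiling-outside s s<d∸1 , complement-tiling-partition s

rectangle∈M₁₀ : ∀ {n} {M : Matrix01 n} (A : SubsetOf n) → (∀ i j → M i j ≡ A i) → InM 1 0 M
rectangle∈M₁₀ A M≡A =
  (λ _ → A) , (λ _ → full)
  , ((λ _ i j Ai _ → trans (M≡A i j) Ai) , λ i j Mij → zero , (trans (sym (M≡A i j)) Mij , refl) , only-zero)
  , (λ _ _ ())
  , ((λ _ → true) , (λ _ _ → z≤n) , (λ _ _ _ _ → refl) , λ _ _ → zero , (refl , refl) , only-zero)
  , λ _ ()
  where
  only-zero : ∀ {P : Fin 1 → Set} l → P l → l ≡ zero
  only-zero zero _ = refl

lemma3p3 : (n : ℕ) → 1 ≤ n →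
    (InM 1 0 (D n 0) × InM 1 0 (D n n)) ×
    (∀ (k : ℕ) → k < n → 0 < k → InM n (gcd n k ∸ 1) (D n k))
lemma3p3 n 1≤n =
  (rectangle∈M₁₀ full (D-n-0-ones n) , rectangle∈M₁₀ (λ _ → false) (D-n-n-zeros n)) , D∈M-gcd
  where
  instance _ = >-nonZero 1≤n
  D∈M-gcd : ∀ k → k < n → 0 < k → InM n (gcd n k ∸ 1) (D n k)
  D∈M-gcd k k<n _ = CirculantRectangles.D∈M n k (gcd n k)
    (gcd[m,n]∣m n k) (∣m∣n⇒∣m∸n (<⇒≤ k<n) (gcd[m,n]∣m n k) (gcd[m,n]∣n n k))
    where
    instance
      gcd≢0 : NonZero (gcd n k)
      gcd≢0 = ≢-nonZero (gcd[m,n]≢0 n k (inj₁ (≢-nonZero⁻¹ n)))
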